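{- Let $r$ be a positive integer and let $\mathbb{D}_{n}^{(r)}(x)$ be defined by $\frac{e^{z}}{(1-xz)^{r}}=\sum_{n\geq0}\mathbb{D}_{n}^{(r)}(x)\frac{z^{n}}{n!}$. Then for every integer $n\ge0$ (and every $z$), \[\det\left(\mathbb{D}_{i+j-2}^{(r)}(z)\right)_{1\leq i,j\leq n+1}=z^{n(n+1)}\,r^{\overline{n}}\prod_{k=1}^{n}r^{\overline{k-1}}\,k!,\] where $r^{\overline{k}}=r(r+1)\cdots(r+k-1)$ and $r^{\overline{0}}=1$.
   Context: The generating function identity is an identity of formal power series in $z$; equivalently $\mathbb{D}_{n}^{(r)}(x)=\sum_{k=0}^{n}\binom{n}{k}r^{\overline{k}}x^{k}$. -}

module Defs where

open import Data.Nat as ℕ using (ℕ; zero; suc; _!)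
open import Data.Nat.Combinatorics using (_C_)
open import Data.Integer using (ℤ; +_; -_; _+_; _*_; _^_)
open import Data.Fin using (Fin; zero; suc; toℕ; punchIn)

rising : ℕ → ℕ → ℕ
rising r zero    = 1
rising r (suc k) = rising r k ℕ.* (r ℕ.+ k)

Σ : (n : ℕ) → (Fin n → ℤ) → ℤ
Σ zero    f = + 0
Σ (suc n) f = f zero + Σ n (λ i → f (suc i))

Π : (n : ℕ) → (Fin n → ℤ) → ℤ
Π zero    f = + 1
Π (suc n) f = f zero * Π n (λ i → f (suc i))

det : (n : ℕ) → (Fin n → Fin n → ℤ) → ℤ
det zero    M = + 1
det (suc n) M =
  Σ (suc n) (λ j → ((- + 1) ^ toℕ j) * M zero j * det n (λ i k → M (suc i) (punchIn j k)))

-- 𝔻ₙ⁽ʳ⁾(x) = Σ_{k=0}^{n} C(n,k) r^(k) x^k   (coefficients of e^z/(1-xz)^r)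
𝔻 : ℕ → ℕ → ℤ → ℤ
𝔻 r n x = Σ (suc n) (λ k → + ((n C toℕ k) ℕ.* rising r (toℕ k)) * (x ^ toℕ k))

-- Two first-order recurrences drive the proof:
--   𝔻⁽ˢ⁾ₘ₊₁ − 𝔻⁽ˢ⁾ₘ = s z 𝔻⁽ˢ⁺¹⁾ₘ   and   𝔻⁽ˢ⁺¹⁾ₘ₊₁ − 𝔻⁽ˢ⁾ₘ₊₁ = (m+1) z 𝔻⁽ˢ⁺¹⁾ₘ.
-- By the first, n rounds of "subtract from each column its left neighbour", each round
-- starting one column further right, turn the Hankel matrix (𝔻⁽ʳ⁾ᵢ₊ⱼ) into
-- (zʲ r⁽ʲ⁾ 𝔻⁽ʳ⁺ʲ⁾ᵢ), and the column factors zʲ r⁽ʲ⁾ leave the determinant.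
-- In (𝔻⁽ˢ⁺ʲ⁾ᵢ) one round of column differences and the second recurrence make the first
-- row (1, 0, …, 0) and row i ≥ 1 divisible by i z; what is left is the same matrix for
-- s + 1 and one size smaller, so its determinant is ∏ₖ zᵏ k!.
module Submission where

open import Defs
open import Data.Nat as ℕ using (ℕ; zero; suc; _!; _≤_; z≤n; s≤s; _⊓_; _∸_)
open import Data.Nat.Combinatorics using (_C_; nCk+nC[k+1]≡[n+1]C[k+1]; k>n⇒nCk≡0; nC1≡n)
import Data.Nat.Properties as ℕₚ
open import Data.Integer using (ℤ; +_; -_; _+_; _*_; _^_; _-_)
import Data.Integer.Properties as ℤₚ
open import Data.Integer.Tactic.RingSolver using (solve-∀)
open import Data.Nat.Tactic.RingSolver using () renaming (solve-∀ to ℕ-solve-∀)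
open import Data.Fin using (Fin; zero; suc; toℕ; inject₁; punchIn; punchOut; fromℕ<; _≟_)
import Data.Fin.Properties as Finₚ
open import Data.Vec.Functional using (updateAt)
open import Data.Vec.Functional.Properties using (updateAt-updates; updateAt-minimal)
open import Data.Product using (∃; _×_; _,_)
open import Data.Empty using (⊥-elim)
open import Function using (_∘_)
open import Relation.Nullary using (yes; no)
open import Relation.Binary.PropositionalEquality
open import Algebra.Properties.CommutativeSemigroup ℤₚ.+-commutativeSemigroup using (interchange)
open import Algebra.Properties.CommutativeSemigroup ℤₚ.*-commutativeSemigroup using (x∙yz≈y∙xz)

Σ-cong : ∀ n {f g : Fin n → ℤ} → (∀ i → f i ≡ g i) → Σ n f ≡ Σ n g
Σ-cong zero    f≗g = refl
Σ-cong (suc n) f≗g = cong₂ _+_ (f≗g zero) (Σ-cong n (f≗g ∘ suc))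

Σ-zero : ∀ n {f : Fin n → ℤ} → (∀ i → f i ≡ + 0) → Σ n f ≡ + 0
Σ-zero zero    f≗0 = refl
Σ-zero (suc n) f≗0 = cong₂ _+_ (f≗0 zero) (Σ-zero n (f≗0 ∘ suc))

Σ-distrib-+ : ∀ n (f g : Fin n → ℤ) → Σ n (λ i → f i + g i) ≡ Σ n f + Σ n g
Σ-distrib-+ zero    f g = refl
Σ-distrib-+ (suc n) f g = begin
  f zero + g zero + Σ n (λ i → f (suc i) + g (suc i))
    ≡⟨ cong (_+_ (f zero + g zero)) (Σ-distrib-+ n (f ∘ suc) (g ∘ suc)) ⟩
  f zero + g zero + (Σ n (f ∘ suc) + Σ n (g ∘ suc))
    ≡⟨ interchange (f zero) (g zero) (Σ n (f ∘ suc)) (Σ n (g ∘ suc)) ⟩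
  f zero + Σ n (f ∘ suc) + (g zero + Σ n (g ∘ suc)) ∎
  where open ≡-Reasoning

Σ-*-distribˡ : ∀ n (c : ℤ) (f : Fin n → ℤ) → Σ n (λ i → c * f i) ≡ c * Σ n f
Σ-*-distribˡ zero    c f = sym (ℤₚ.*-zeroʳ c)
Σ-*-distribˡ (suc n) c f = begin
  c * f zero + Σ n (λ i → c * f (suc i)) ≡⟨ cong (_+_ (c * f zero)) (Σ-*-distribˡ n c (f ∘ suc)) ⟩
  c * f zero + c * Σ n (f ∘ suc)          ≡⟨ ℤₚ.*-distribˡ-+ c (f zero) (Σ n (f ∘ suc)) ⟨
  c * (f zero + Σ n (f ∘ suc))            ∎
  where open ≡-Reasoning

Σ-support₁ : ∀ n (f : Fin n → ℤ) (a : Fin n) → (∀ i → i ≢ a → f i ≡ + 0) → Σ n f ≡ f a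
Σ-support₁ (suc n) f zero    f≗0 =
  trans (cong (_+_ (f zero)) (Σ-zero n (λ i → f≗0 (suc i) λ ()))) (ℤₚ.+-identityʳ (f zero))
Σ-support₁ (suc n) f (suc a) f≗0 =
  trans (cong₂ _+_ (f≗0 zero λ ())
                   (Σ-support₁ n (f ∘ suc) a (λ i i≢a → f≗0 (suc i) (i≢a ∘ Finₚ.suc-injective))))
        (ℤₚ.+-identityˡ (f (suc a)))

Σ-support₂ : ∀ n (f : Fin n → ℤ) {a b : Fin n} → a ≢ b →
             (∀ i → i ≢ a → i ≢ b → f i ≡ + 0) → Σ n f ≡ f a + f b
Σ-support₂ (suc n) f {zero}  {zero}  a≢b f≗0 = ⊥-elim (a≢b refl)
Σ-support₂ (suc n) f {zero}  {suc b} a≢b f≗0 =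
  cong (_+_ (f zero)) (Σ-support₁ n (f ∘ suc) b (λ i i≢b → f≗0 (suc i) (λ ()) (i≢b ∘ Finₚ.suc-injective)))
Σ-support₂ (suc n) f {suc a} {zero}  a≢b f≗0 =
  trans (cong (_+_ (f zero))
              (Σ-support₁ n (f ∘ suc) a (λ i i≢a → f≗0 (suc i) (i≢a ∘ Finₚ.suc-injective) (λ ()))))
        (ℤₚ.+-comm (f zero) (f (suc a)))
Σ-support₂ (suc n) f {suc a} {suc b} a≢b f≗0 =
  trans (cong₂ _+_ (f≗0 zero (λ ()) (λ ()))
                   (Σ-support₂ n (f ∘ suc) (a≢b ∘ cong suc)
                     (λ i i≢a i≢b → f≗0 (suc i) (i≢a ∘ Finₚ.suc-injective) (i≢b ∘ Finₚ.suc-injective))))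
        (ℤₚ.+-identityˡ (f (suc a) + f (suc b)))

Σ-last : ∀ n (f : ℕ → ℤ) → Σ (suc n) (f ∘ toℕ) ≡ Σ n (f ∘ toℕ) + f n
Σ-last zero    f = trans (ℤₚ.+-identityʳ (f 0)) (sym (ℤₚ.+-identityˡ (f 0)))
Σ-last (suc n) f = trans (cong (_+_ (f 0)) (Σ-last n (f ∘ suc))) (sym (ℤₚ.+-assoc (f 0) _ (f (suc n))))

Π-last : ∀ n (f : ℕ → ℤ) → Π (suc n) (f ∘ toℕ) ≡ Π n (f ∘ toℕ) * f n
Π-last zero    f = trans (ℤₚ.*-identityʳ (f 0)) (sym (ℤₚ.*-identityˡ (f 0)))
Π-last (suc n) f = trans (cong (f 0 *_) (Π-last n (f ∘ suc))) (sym (ℤₚ.*-assoc (f 0) _ (f (suc n))))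

Π-punchIn : ∀ n (f : Fin (suc n) → ℤ) (j : Fin (suc n)) → Π (suc n) f ≡ f j * Π n (f ∘ punchIn j)
Π-punchIn n       f zero    = refl
Π-punchIn (suc n) f (suc j) = begin
  f zero * Π (suc n) (f ∘ suc)                      ≡⟨ cong (f zero *_) (Π-punchIn n (f ∘ suc) j) ⟩
  f zero * (f (suc j) * Π n (f ∘ suc ∘ punchIn j))  ≡⟨ x∙yz≈y∙xz (f zero) (f (suc j)) _ ⟩
  f (suc j) * (f zero * Π n (f ∘ suc ∘ punchIn j))  ∎
  where open ≡-Reasoning

sign : ∀ {n} → Fin n → ℤ
sign j = (- + 1) ^ toℕ j

minor : ∀ {n} → (Fin (suc n) → Fin (suc n) → ℤ) → Fin (suc n) → Fin n → Fin n → ℤ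
minor M j i k = M (suc i) (punchIn j k)

laplaceTerm : ∀ {n} → (Fin (suc n) → Fin (suc n) → ℤ) → Fin (suc n) → ℤ
laplaceTerm {n} M j = sign j * M zero j * det n (minor M j)

det-cong : ∀ n {M N : Fin n → Fin n → ℤ} → (∀ i j → M i j ≡ N i j) → det n M ≡ det n N
det-cong zero    M≗N = refl
det-cong (suc n) M≗N = Σ-cong (suc n) λ j →
  cong₂ (λ x d → sign j * x * d) (M≗N zero j) (det-cong n (λ i k → M≗N (suc i) (punchIn j k)))

det-scale-columns : ∀ n (c : Fin n → ℤ) (M : Fin n → Fin n → ℤ) →
                    det n (λ i j → c j * M i j) ≡ Π n c * det n M
det-scale-columns zero    c M = refl
det-scale-columns (suc n) c M =
  trans (Σ-cong (suc n) scale-term) (Σ-*-distribˡ (suc n) (Π (suc n) c) (laplaceTerm M))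
  where
  rearrange : ∀ s a x p d → s * (a * x) * (p * d) ≡ a * p * (s * x * d)
  rearrange = solve-∀
  scale-term : ∀ j → laplaceTerm (λ i j → c j * M i j) j ≡ Π (suc n) c * laplaceTerm M j
  scale-term j = begin
    sign j * (c j * M zero j) * det n (λ i k → c (punchIn j k) * minor M j i k)
      ≡⟨ cong (sign j * (c j * M zero j) *_) (det-scale-columns n (c ∘ punchIn j) (minor M j)) ⟩
    sign j * (c j * M zero j) * (Π n (c ∘ punchIn j) * det n (minor M j))
      ≡⟨ rearrange (sign j) (c j) (M zero j) _ _ ⟩
    c j * Π n (c ∘ punchIn j) * (sign j * M zero j * det n (minor M j))
      ≡⟨ cong (_* (sign j * M zero j * det n (minor M j))) (Π-punchIn n c j) ⟨
    Π (suc n) c * (sign j * M zero j * det n (minor M j)) ∎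
    where open ≡-Reasoning

det-scale-rows : ∀ n (c : Fin n → ℤ) (M : Fin n → Fin n → ℤ) →
                 det n (λ i j → c i * M i j) ≡ Π n c * det n M
det-scale-rows zero    c M = refl
det-scale-rows (suc n) c M =
  trans (Σ-cong (suc n) scale-term) (Σ-*-distribˡ (suc n) (Π (suc n) c) (laplaceTerm M))
  where
  rearrange : ∀ s a x p d → s * (a * x) * (p * d) ≡ a * p * (s * x * d)
  rearrange = solve-∀
  scale-term : ∀ j → laplaceTerm (λ i j → c i * M i j) j ≡ Π (suc n) c * laplaceTerm M j
  scale-term j = begin
    sign j * (c zero * M zero j) * det n (λ i k → c (suc i) * minor M j i k)
      ≡⟨ cong (sign j * (c zero * M zero j) *_) (det-scale-rows n (c ∘ suc) (minor M j)) ⟩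
    sign j * (c zero * M zero j) * (Π n (c ∘ suc) * det n (minor M j))
      ≡⟨ rearrange (sign j) (c zero) (M zero j) _ _ ⟩
    Π (suc n) c * (sign j * M zero j * det n (minor M j)) ∎
    where open ≡-Reasoning

det-first-row-pivot : ∀ n (M : Fin (suc n) → Fin (suc n) → ℤ) → (∀ k → M zero (suc k) ≡ + 0) →
                      det (suc n) M ≡ M zero zero * det n (λ i k → M (suc i) (suc k))
det-first-row-pivot n M row₀ =
  trans (Σ-support₁ (suc n) (laplaceTerm M) zero off-pivot)
        (cong (_* det n (minor M zero)) (ℤₚ.*-identityˡ (M zero zero)))
  where
  off-pivot : ∀ j → j ≢ zero → laplaceTerm M j ≡ + 0
  off-pivot zero    0≢0 = ⊥-elim (0≢0 refl)
  off-pivot (suc k) _   = begin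
    sign (suc k) * M zero (suc k) * det n (minor M (suc k))
      ≡⟨ cong (λ x → sign (suc k) * x * det n (minor M (suc k))) (row₀ k) ⟩
    sign (suc k) * + 0 * det n (minor M (suc k))
      ≡⟨ cong (_* det n (minor M (suc k))) (ℤₚ.*-zeroʳ (sign (suc k))) ⟩
    + 0 ∎
    where open ≡-Reasoning

laplaceTerm-linear-column : ∀ {n} (A B M : Fin (suc n) → Fin (suc n) → ℤ) (c : ℤ) (j : Fin (suc n)) →
                            (∀ i l → l ≢ j → A i l ≡ M i l) → (∀ i l → l ≢ j → B i l ≡ M i l) →
                            M zero j ≡ A zero j + c * B zero j →
                            laplaceTerm M j ≡ laplaceTerm A j + c * laplaceTerm B j
laplaceTerm-linear-column {n} A B M c j A≗M B≗M M₀ⱼ = begin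
  sign j * M zero j * det n (minor M j)
    ≡⟨ cong₂ (λ x d → sign j * x * d) M₀ⱼ (sym minorA≡minorM) ⟩
  sign j * (A zero j + c * B zero j) * det n (minor A j)
    ≡⟨ distribute (sign j) (A zero j) (B zero j) c (det n (minor A j)) ⟩
  laplaceTerm A j + c * (sign j * B zero j * det n (minor A j))
    ≡⟨ cong (λ d → laplaceTerm A j + c * (sign j * B zero j * d)) minorA≡minorB ⟩
  laplaceTerm A j + c * laplaceTerm B j ∎
  where
  open ≡-Reasoning
  distribute : ∀ s a b c d → s * (a + c * b) * d ≡ s * a * d + c * (s * b * d)
  distribute = solve-∀
  minorA≡minorM : det n (minor A j) ≡ det n (minor M j)
  minorA≡minorM = det-cong n λ i k → A≗M (suc i) (punchIn j k) (Finₚ.punchInᵢ≢i j k)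
  minorA≡minorB : det n (minor A j) ≡ det n (minor B j)
  minorA≡minorB = trans minorA≡minorM
                        (sym (det-cong n λ i k → B≗M (suc i) (punchIn j k) (Finₚ.punchInᵢ≢i j k)))

det-linear-column : ∀ n (A B M : Fin n → Fin n → ℤ) (c : ℤ) (j : Fin n) →
                    (∀ i l → l ≢ j → A i l ≡ M i l) → (∀ i l → l ≢ j → B i l ≡ M i l) →
                    (∀ i → M i j ≡ A i j + c * B i j) → det n M ≡ det n A + c * det n B
det-linear-column zero    A B M c () A≗M B≗M Mⱼ
det-linear-column (suc n) A B M c j A≗M B≗M Mⱼ = begin
  Σ (suc n) (laplaceTerm M)
    ≡⟨ Σ-cong (suc n) split-term ⟩
  Σ (suc n) (λ l → laplaceTerm A l + c * laplaceTerm B l)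
    ≡⟨ Σ-distrib-+ (suc n) (laplaceTerm A) (λ l → c * laplaceTerm B l) ⟩
  det (suc n) A + Σ (suc n) (λ l → c * laplaceTerm B l)
    ≡⟨ cong (_+_ (det (suc n) A)) (Σ-*-distribˡ (suc n) c (laplaceTerm B)) ⟩
  det (suc n) A + c * det (suc n) B ∎
  where
  open ≡-Reasoning
  split-term : ∀ l → laplaceTerm M l ≡ laplaceTerm A l + c * laplaceTerm B l
  split-term l with l ≟ j
  ... | yes refl = laplaceTerm-linear-column A B M c l A≗M B≗M (Mⱼ zero)
  ... | no l≢j = begin
    sign l * M zero l * det n (minor M l)
      ≡⟨ cong₂ (λ x d → sign l * x * d) (sym (A≗M zero l l≢j)) minor-linear ⟩
    sign l * A zero l * (det n (minor A l) + c * det n (minor B l))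
      ≡⟨ distribute (sign l) (A zero l) c (det n (minor A l)) (det n (minor B l)) ⟩
    laplaceTerm A l + c * (sign l * A zero l * det n (minor B l))
      ≡⟨ cong (λ x → laplaceTerm A l + c * (sign l * x * det n (minor B l)))
              (trans (A≗M zero l l≢j) (sym (B≗M zero l l≢j))) ⟩
    laplaceTerm A l + c * laplaceTerm B l ∎
    where
    distribute : ∀ s a c x y → s * a * (x + c * y) ≡ s * a * x + c * (s * a * y)
    distribute = solve-∀
    j′ : Fin n
    j′ = punchOut l≢j
    punchIn-j′ : punchIn l j′ ≡ j
    punchIn-j′ = Finₚ.punchIn-punchOut l≢j
    off-column : ∀ k → k ≢ j′ → punchIn l k ≢ j
    off-column k k≢j′ eq = k≢j′ (Finₚ.punchIn-injective l k j′ (trans eq (sym punchIn-j′)))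
    minor-linear : det n (minor M l) ≡ det n (minor A l) + c * det n (minor B l)
    minor-linear = det-linear-column n (minor A l) (minor B l) (minor M l) c j′
      (λ i k k≢j′ → A≗M (suc i) (punchIn l k) (off-column k k≢j′))
      (λ i k k≢j′ → B≗M (suc i) (punchIn l k) (off-column k k≢j′))
      (λ i → subst (λ q → M (suc i) q ≡ A (suc i) q + c * B (suc i) q) (sym punchIn-j′) (Mⱼ (suc i)))

inject₁≢suc : ∀ {n} (a : Fin n) → inject₁ a ≢ suc a
inject₁≢suc (suc a) eq = inject₁≢suc a (Finₚ.suc-injective eq)

punchIn-adjacent-equal : ∀ {n} {A : Set} (v : Fin (suc n) → A) (a : Fin n) → v (inject₁ a) ≡ v (suc a) →
                         ∀ k → v (punchIn (inject₁ a) k) ≡ v (punchIn (suc a) k)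
punchIn-adjacent-equal v zero    eq zero    = sym eq
punchIn-adjacent-equal v zero    eq (suc k) = refl
punchIn-adjacent-equal v (suc a) eq zero    = refl
punchIn-adjacent-equal v (suc a) eq (suc k) = punchIn-adjacent-equal (v ∘ suc) a eq k

punchOut-adjacent : ∀ {n} (l : Fin (suc (suc n))) (a : Fin (suc n)) → l ≢ inject₁ a → l ≢ suc a →
                    ∃ λ (a′ : Fin n) → punchIn l (inject₁ a′) ≡ inject₁ a × punchIn l (suc a′) ≡ suc a
punchOut-adjacent zero          zero    l≢a _     = ⊥-elim (l≢a refl)
punchOut-adjacent zero          (suc a) _   _     = a , refl , refl
punchOut-adjacent (suc zero)    zero    _   l≢a+1 = ⊥-elim (l≢a+1 refl)
punchOut-adjacent {suc n} (suc (suc l)) zero _ _  = zero , refl , refl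
punchOut-adjacent {suc n} (suc l) (suc a) l≢a l≢a+1 with punchOut-adjacent l a (l≢a ∘ cong suc) (l≢a+1 ∘ cong suc)
... | a′ , p , q = suc a′ , cong suc p , cong suc q

det-equal-adjacent-columns : ∀ n (M : Fin (suc n) → Fin (suc n) → ℤ) (a : Fin n) →
                             (∀ i → M i (inject₁ a) ≡ M i (suc a)) → det (suc n) M ≡ + 0
det-equal-adjacent-columns (suc n) M a equal = begin
  det (suc (suc n)) M
    ≡⟨ Σ-support₂ (suc (suc n)) (laplaceTerm M) (inject₁≢suc a) off-pair ⟩
  laplaceTerm M (inject₁ a) + laplaceTerm M (suc a)
    ≡⟨ cong (_+_ (laplaceTerm M (inject₁ a))) swapped ⟩
  laplaceTerm M (inject₁ a) + (- + 1) * laplaceTerm M (inject₁ a)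
    ≡⟨ cancel (laplaceTerm M (inject₁ a)) ⟩
  + 0 ∎
  where
  open ≡-Reasoning
  cancel : ∀ x → x + (- + 1) * x ≡ + 0
  cancel = solve-∀
  reassociate : ∀ s x d → (- + 1) * s * x * d ≡ (- + 1) * (s * x * d)
  reassociate = solve-∀
  minors-agree : det (suc n) (minor M (inject₁ a)) ≡ det (suc n) (minor M (suc a))
  minors-agree = det-cong (suc n) λ i → punchIn-adjacent-equal (M (suc i)) a (equal (suc i))
  swapped : laplaceTerm M (suc a) ≡ (- + 1) * laplaceTerm M (inject₁ a)
  swapped = begin
    (- + 1) * sign a * M zero (suc a) * det (suc n) (minor M (suc a))
      ≡⟨ cong₂ (λ x d → (- + 1) * sign a * x * d) (sym (equal zero)) (sym minors-agree) ⟩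
    (- + 1) * sign a * M zero (inject₁ a) * det (suc n) (minor M (inject₁ a))
      ≡⟨ cong (λ s → (- + 1) * s * M zero (inject₁ a) * det (suc n) (minor M (inject₁ a)))
              (cong ((- + 1) ^_) (sym (Finₚ.toℕ-inject₁ a))) ⟩
    (- + 1) * sign (inject₁ a) * M zero (inject₁ a) * det (suc n) (minor M (inject₁ a))
      ≡⟨ reassociate (sign (inject₁ a)) (M zero (inject₁ a)) _ ⟩
    (- + 1) * laplaceTerm M (inject₁ a) ∎
  off-pair : ∀ l → l ≢ inject₁ a → l ≢ suc a → laplaceTerm M l ≡ + 0
  off-pair l l≢a l≢a+1 with punchOut-adjacent l a l≢a l≢a+1
  ... | a′ , p , q = trans (cong (sign l * M zero l *_) minor-singular) (ℤₚ.*-zeroʳ (sign l * M zero l))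
    where
    minor-singular : det (suc n) (minor M l) ≡ + 0
    minor-singular = det-equal-adjacent-columns n (minor M l) a′ λ i →
      trans (cong (M (suc i)) p) (trans (equal (suc i)) (cong (M (suc i)) (sym q)))

det-add-previous-column : ∀ n (A M : Fin (suc n) → Fin (suc n) → ℤ) (c : ℤ) (a : Fin n) →
                          (∀ i l → l ≢ suc a → M i l ≡ A i l) →
                          (∀ i → M i (suc a) ≡ A i (suc a) + c * A i (inject₁ a)) → det (suc n) M ≡ det (suc n) A
det-add-previous-column n A M c a M≗A Mₐ = begin
  det (suc n) M                     ≡⟨ det-linear-column (suc n) A B M c (suc a) A≗M B≗M M-column ⟩
  det (suc n) A + c * det (suc n) B ≡⟨ cong (λ d → det (suc n) A + c * d) B-singular ⟩
  det (suc n) A + c * + 0           ≡⟨ cong (_+_ (det (suc n) A)) (ℤₚ.*-zeroʳ c) ⟩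
  det (suc n) A + + 0               ≡⟨ ℤₚ.+-identityʳ (det (suc n) A) ⟩
  det (suc n) A                     ∎
  where
  open ≡-Reasoning
  B : Fin (suc n) → Fin (suc n) → ℤ
  B i = updateAt (A i) (suc a) (λ _ → A i (inject₁ a))
  A≗M : ∀ i l → l ≢ suc a → A i l ≡ M i l
  A≗M i l l≢a+1 = sym (M≗A i l l≢a+1)
  B≗M : ∀ i l → l ≢ suc a → B i l ≡ M i l
  B≗M i l l≢a+1 = trans (updateAt-minimal l (suc a) (A i) l≢a+1) (A≗M i l l≢a+1)
  M-column : ∀ i → M i (suc a) ≡ A i (suc a) + c * B i (suc a)
  M-column i = trans (Mₐ i) (cong (λ x → A i (suc a) + c * x) (sym (updateAt-updates (suc a) (A i))))
  B-singular : det (suc n) B ≡ + 0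
  B-singular = det-equal-adjacent-columns n B a λ i →
    trans (updateAt-minimal (inject₁ a) (suc a) (A i) (inject₁≢suc a)) (sym (updateAt-updates (suc a) (A i)))

matrix : (ℕ → ℕ → ℤ) → (m : ℕ) → Fin m → Fin m → ℤ
matrix F m i j = F (toℕ i) (toℕ j)

differenceColumnsAbove : ℕ → (ℕ → ℕ → ℤ) → ℕ → ℕ → ℤ
differenceColumnsAbove t F i zero    = F i zero
differenceColumnsAbove t F i (suc j) with t ℕₚ.≤? j
... | yes _ = F i (suc j) - F i j
... | no  _ = F i (suc j)

differenceColumnsAbove-≤ : ∀ t F i j → j ≤ t → differenceColumnsAbove t F i j ≡ F i j
differenceColumnsAbove-≤ t F i zero    _   = refl
differenceColumnsAbove-≤ t F i (suc j) j<t with t ℕₚ.≤? j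
... | yes t≤j = ⊥-elim (ℕₚ.<-irrefl refl (ℕₚ.<-≤-trans j<t t≤j))
... | no  _   = refl

differenceColumnsAbove-> : ∀ t F i j → t ≤ j → differenceColumnsAbove t F i (suc j) ≡ F i (suc j) - F i j
differenceColumnsAbove-> t F i j t≤j with t ℕₚ.≤? j
... | yes _   = refl
... | no  t≰j = ⊥-elim (t≰j t≤j)

differenceColumnsAbove-≢ : ∀ t F i j → j ≢ suc t →
                           differenceColumnsAbove t F i j ≡ differenceColumnsAbove (suc t) F i j
differenceColumnsAbove-≢ t F i zero    _ = refl
differenceColumnsAbove-≢ t F i (suc j) j≢t+1 with t ℕₚ.≤? j | suc t ℕₚ.≤? j
... | yes _   | yes _     = refl
... | no  _   | no  _     = refl
... | yes t≤j | no  t+1≰j = ⊥-elim (j≢t+1 (cong suc (ℕₚ.≤-antisym (ℕₚ.≮⇒≥ t+1≰j) t≤j)))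
... | no  t≰j | yes t+1≤j = ⊥-elim (t≰j (ℕₚ.<⇒≤ t+1≤j))

-- The two matrices differ only in column t + 1, by column t, which they share.
det-differenceColumnsAbove-suc : ∀ m F t → det m (matrix (differenceColumnsAbove t F) m)
                                         ≡ det m (matrix (differenceColumnsAbove (suc t) F) m)
det-differenceColumnsAbove-suc zero    F t = refl
det-differenceColumnsAbove-suc (suc m) F t with t ℕₚ.<? m
... | yes t<m = det-add-previous-column m _ _ (- + 1) a
  (λ i l l≢a+1 → differenceColumnsAbove-≢ t F (toℕ i) (toℕ l) (l≢a+1 ∘ toℕ≡1+t⇒≡suc-a))
  (λ i → subst₂ (λ p q → Δₜ (toℕ i) (suc p) ≡ Δₜ₊₁ (toℕ i) (suc p) + (- + 1) * Δₜ₊₁ (toℕ i) q)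
                (sym toℕ-a) (sym (trans (Finₚ.toℕ-inject₁ a) toℕ-a)) (column-t+1 (toℕ i)))
  where
  open ≡-Reasoning
  Δₜ Δₜ₊₁ : ℕ → ℕ → ℤ
  Δₜ   = differenceColumnsAbove t F
  Δₜ₊₁ = differenceColumnsAbove (suc t) F
  a : Fin m
  a = fromℕ< t<m
  toℕ-a : toℕ a ≡ t
  toℕ-a = Finₚ.toℕ-fromℕ< t<m
  toℕ≡1+t⇒≡suc-a : ∀ {l} → toℕ l ≡ suc t → l ≡ suc a
  toℕ≡1+t⇒≡suc-a eq = Finₚ.toℕ-injective (trans eq (cong suc (sym toℕ-a)))
  subtract : ∀ x y → x - y ≡ x + (- + 1) * y
  subtract = solve-∀
  column-t+1 : ∀ i → Δₜ i (suc t) ≡ Δₜ₊₁ i (suc t) + (- + 1) * Δₜ₊₁ i t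
  column-t+1 i = begin
    Δₜ i (suc t)                  ≡⟨ differenceColumnsAbove-> t F i t ℕₚ.≤-refl ⟩
    F i (suc t) - F i t           ≡⟨ subtract (F i (suc t)) (F i t) ⟩
    F i (suc t) + (- + 1) * F i t ≡⟨ cong₂ (λ x y → x + (- + 1) * y)
                                           (differenceColumnsAbove-≤ (suc t) F i (suc t) ℕₚ.≤-refl)
                                           (differenceColumnsAbove-≤ (suc t) F i t (ℕₚ.n≤1+n t)) ⟨
    Δₜ₊₁ i (suc t) + (- + 1) * Δₜ₊₁ i t ∎
... | no  t≮m = det-cong (suc m) λ i j →
  let j≤t = ℕₚ.≤-trans (ℕ.s≤s⁻¹ (Finₚ.toℕ<n j)) (ℕₚ.≮⇒≥ t≮m) in
  trans (differenceColumnsAbove-≤ t F (toℕ i) (toℕ j) j≤t)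
        (sym (differenceColumnsAbove-≤ (suc t) F (toℕ i) (toℕ j) (ℕₚ.m≤n⇒m≤1+n j≤t)))

det-differenceColumnsAbove : ∀ m F t → det m (matrix (differenceColumnsAbove t F) m) ≡ det m (matrix F m)
det-differenceColumnsAbove m F t = trans (iterate m) (det-cong m λ i j →
  differenceColumnsAbove-≤ (m ℕ.+ t) F (toℕ i) (toℕ j)
    (ℕₚ.≤-trans (ℕₚ.<⇒≤ (Finₚ.toℕ<n j)) (ℕₚ.m≤m+n m t)))
  where
  iterate : ∀ d → det m (matrix (differenceColumnsAbove t F) m) ≡ det m (matrix (differenceColumnsAbove (d ℕ.+ t) F) m)
  iterate zero    = refl
  iterate (suc d) = trans (iterate d) (det-differenceColumnsAbove-suc m F (d ℕ.+ t))

rising-suc : ∀ s k → rising s (suc k) ≡ s ℕ.* rising (suc s) k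
rising-suc s zero    = trans (ℕₚ.+-identityʳ (s ℕ.+ 0)) (trans (ℕₚ.+-identityʳ s) (sym (ℕₚ.*-identityʳ s)))
rising-suc s (suc k) = begin
  rising s (suc k) ℕ.* (s ℕ.+ suc k)           ≡⟨ cong₂ ℕ._*_ (rising-suc s k) (ℕₚ.+-suc s k) ⟩
  s ℕ.* rising (suc s) k ℕ.* (suc s ℕ.+ k)     ≡⟨ ℕₚ.*-assoc s (rising (suc s) k) (suc s ℕ.+ k) ⟩
  s ℕ.* (rising (suc s) k ℕ.* (suc s ℕ.+ k))   ∎
  where open ≡-Reasoning

rising-suc-base : ∀ s k → rising (suc s) (suc k) ≡ rising s (suc k) ℕ.+ suc k ℕ.* rising (suc s) k
rising-suc-base s k = begin
  rising (suc s) k ℕ.* (suc s ℕ.+ k)                      ≡⟨ split s k (rising (suc s) k) ⟩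
  s ℕ.* rising (suc s) k ℕ.+ suc k ℕ.* rising (suc s) k
    ≡⟨ cong (ℕ._+ suc k ℕ.* rising (suc s) k) (rising-suc s k) ⟨
  rising s (suc k) ℕ.+ suc k ℕ.* rising (suc s) k        ∎
  where
  open ≡-Reasoning
  split : ∀ s k r → r ℕ.* (suc s ℕ.+ k) ≡ s ℕ.* r ℕ.+ suc k ℕ.* r
  split = ℕ-solve-∀

[1+k]*[1+m]C[1+k]≡[1+m]*mCk : ∀ m k → suc k ℕ.* (suc m C suc k) ≡ suc m ℕ.* (m C k)
[1+k]*[1+m]C[1+k]≡[1+m]*mCk zero    zero    = refl
[1+k]*[1+m]C[1+k]≡[1+m]*mCk zero    (suc k) = ℕₚ.*-zeroʳ (suc (suc k))
[1+k]*[1+m]C[1+k]≡[1+m]*mCk (suc m) zero    =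
  trans (ℕₚ.*-identityˡ (suc (suc m) C 1)) (trans (nC1≡n (suc (suc m))) (sym (ℕₚ.*-identityʳ (suc (suc m)))))
[1+k]*[1+m]C[1+k]≡[1+m]*mCk (suc m) (suc k) = begin
  suc (suc k) ℕ.* (suc (suc m) C suc (suc k))
    ≡⟨ cong (suc (suc k) ℕ.*_) (nCk+nC[k+1]≡[n+1]C[k+1] (suc m) (suc k)) ⟨
  suc (suc k) ℕ.* (suc m C suc k ℕ.+ suc m C suc (suc k))
    ≡⟨ expand (suc m C suc k) (suc m C suc (suc k)) ⟩
  suc m C suc k ℕ.+ suc k ℕ.* (suc m C suc k) ℕ.+ suc (suc k) ℕ.* (suc m C suc (suc k))
    ≡⟨ cong₂ (λ x y → suc m C suc k ℕ.+ x ℕ.+ y)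
             ([1+k]*[1+m]C[1+k]≡[1+m]*mCk m k) ([1+k]*[1+m]C[1+k]≡[1+m]*mCk m (suc k)) ⟩
  suc m C suc k ℕ.+ suc m ℕ.* (m C k) ℕ.+ suc m ℕ.* (m C suc k)
    ≡⟨ collect (suc m C suc k) (m C k) (m C suc k) ⟩
  suc m C suc k ℕ.+ suc m ℕ.* (m C k ℕ.+ m C suc k)
    ≡⟨ cong (λ x → suc m C suc k ℕ.+ suc m ℕ.* x) (nCk+nC[k+1]≡[n+1]C[k+1] m k) ⟩
  suc (suc m) ℕ.* (suc m C suc k) ∎
  where
  open ≡-Reasoning
  expand : ∀ x y → suc (suc k) ℕ.* (x ℕ.+ y) ≡ x ℕ.+ suc k ℕ.* x ℕ.+ suc (suc k) ℕ.* y
  expand x y = ℕₚ.*-distribˡ-+ (suc (suc k)) x y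
  collect : ∀ c a b → c ℕ.+ suc m ℕ.* a ℕ.+ suc m ℕ.* b ≡ c ℕ.+ suc m ℕ.* (a ℕ.+ b)
  collect c a b = trans (ℕₚ.+-assoc c _ _) (cong (c ℕ.+_) (sym (ℕₚ.*-distribˡ-+ (suc m) a b)))

poly : ℕ → (ℕ → ℕ) → ℤ → ℤ
poly d c x = Σ d (λ k → + c (toℕ k) * x ^ toℕ k)

poly-cong : ∀ d {c c′ : ℕ → ℕ} x → (∀ k → c k ≡ c′ k) → poly d c x ≡ poly d c′ x
poly-cong d x c≗c′ = Σ-cong d λ k → cong (λ a → + a * x ^ toℕ k) (c≗c′ (toℕ k))

poly-+ : ∀ d (c c′ : ℕ → ℕ) x → poly d (λ k → c k ℕ.+ c′ k) x ≡ poly d c x + poly d c′ x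
poly-+ d c c′ x = trans (Σ-cong d distribute) (Σ-distrib-+ d _ _)
  where
  distribute : ∀ k → + (c (toℕ k) ℕ.+ c′ (toℕ k)) * x ^ toℕ k ≡ + c (toℕ k) * x ^ toℕ k + + c′ (toℕ k) * x ^ toℕ k
  distribute k = trans (cong (_* x ^ toℕ k) (ℤₚ.pos-+ (c (toℕ k)) (c′ (toℕ k))))
                       (ℤₚ.*-distribʳ-+ (x ^ toℕ k) (+ c (toℕ k)) (+ c′ (toℕ k)))

poly-* : ∀ d a (c : ℕ → ℕ) x → poly d (λ k → a ℕ.* c k) x ≡ + a * poly d c x
poly-* d a c x = trans (Σ-cong d factor) (Σ-*-distribˡ d (+ a) _)
  where
  factor : ∀ k → + (a ℕ.* c (toℕ k)) * x ^ toℕ k ≡ + a * (+ c (toℕ k) * x ^ toℕ k)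
  factor k = trans (cong (_* x ^ toℕ k) (ℤₚ.pos-* a (c (toℕ k)))) (ℤₚ.*-assoc (+ a) _ _)

poly-suc : ∀ d (c : ℕ → ℕ) x → poly (suc d) c x ≡ + c 0 + x * poly d (c ∘ suc) x
poly-suc d c x = cong₂ _+_ (ℤₚ.*-identityʳ (+ c 0)) (trans (Σ-cong d factor) (Σ-*-distribˡ d x _))
  where
  factor : ∀ k → + c (suc (toℕ k)) * (x * x ^ toℕ k) ≡ x * (+ c (suc (toℕ k)) * x ^ toℕ k)
  factor k = x∙yz≈y∙xz (+ c (suc (toℕ k))) x (x ^ toℕ k)

poly-last-zero : ∀ d (c : ℕ → ℕ) x → c d ≡ 0 → poly (suc d) c x ≡ poly d c x
poly-last-zero d c x c[d]≡0 = begin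
  poly (suc d) c x             ≡⟨ Σ-last d (λ k → + c k * x ^ k) ⟩
  poly d c x + + c d * x ^ d   ≡⟨ cong (λ a → poly d c x + + a * x ^ d) c[d]≡0 ⟩
  poly d c x + + 0             ≡⟨ ℤₚ.+-identityʳ (poly d c x) ⟩
  poly d c x                   ∎
  where open ≡-Reasoning

-- 𝔻 r n x is definitionally poly (suc n) (𝔻-coefficient r n) x.
𝔻-coefficient : ℕ → ℕ → ℕ → ℕ
𝔻-coefficient r n k = (n C k) ℕ.* rising r k

𝔻-difference-in-n : ∀ s m x → 𝔻 s (suc m) x ≡ 𝔻 s m x + + s * x * 𝔻 (suc s) m x
𝔻-difference-in-n s m x = begin
  𝔻 s (suc m) x
    ≡⟨ poly-suc (suc m) (𝔻-coefficient s (suc m)) x ⟩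
  + 1 + x * poly (suc m) (λ k → (suc m C suc k) ℕ.* rising s (suc k)) x
    ≡⟨ cong (λ p → + 1 + x * p) (poly-cong (suc m) x pascal) ⟩
  + 1 + x * poly (suc m) (λ k → s ℕ.* 𝔻-coefficient (suc s) m k ℕ.+ shifted k) x
    ≡⟨ cong (λ p → + 1 + x * p) (poly-+ (suc m) (λ k → s ℕ.* 𝔻-coefficient (suc s) m k) shifted x) ⟩
  + 1 + x * (poly (suc m) (λ k → s ℕ.* 𝔻-coefficient (suc s) m k) x + poly (suc m) shifted x)
    ≡⟨ cong₂ (λ p q → + 1 + x * (p + q)) (poly-* (suc m) s (𝔻-coefficient (suc s) m) x)
             (poly-last-zero m shifted x (cong (ℕ._* rising s (suc m)) (k>n⇒nCk≡0 (ℕₚ.n<1+n m)))) ⟩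
  + 1 + x * (+ s * 𝔻 (suc s) m x + poly m shifted x)
    ≡⟨ rearrange x (+ s) (𝔻 (suc s) m x) (poly m shifted x) ⟩
  + 1 + x * poly m shifted x + + s * x * 𝔻 (suc s) m x
    ≡⟨ cong (_+ + s * x * 𝔻 (suc s) m x) (poly-suc m (𝔻-coefficient s m) x) ⟨
  𝔻 s m x + + s * x * 𝔻 (suc s) m x ∎
  where
  open ≡-Reasoning
  shifted : ℕ → ℕ
  shifted k = (m C suc k) ℕ.* rising s (suc k)
  rearrange : ∀ x a d p → + 1 + x * (a * d + p) ≡ + 1 + x * p + a * x * d
  rearrange = solve-∀
  left-commute : ∀ a b c → a ℕ.* (b ℕ.* c) ≡ b ℕ.* (a ℕ.* c)
  left-commute = ℕ-solve-∀
  pascal : ∀ k → (suc m C suc k) ℕ.* rising s (suc k) ≡ s ℕ.* 𝔻-coefficient (suc s) m k ℕ.+ shifted k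
  pascal k = begin
    (suc m C suc k) ℕ.* rising s (suc k)
      ≡⟨ cong (ℕ._* rising s (suc k)) (nCk+nC[k+1]≡[n+1]C[k+1] m k) ⟨
    (m C k ℕ.+ m C suc k) ℕ.* rising s (suc k)
      ≡⟨ ℕₚ.*-distribʳ-+ (rising s (suc k)) (m C k) (m C suc k) ⟩
    (m C k) ℕ.* rising s (suc k) ℕ.+ shifted k
      ≡⟨ cong (λ r → (m C k) ℕ.* r ℕ.+ shifted k) (rising-suc s k) ⟩
    (m C k) ℕ.* (s ℕ.* rising (suc s) k) ℕ.+ shifted k
      ≡⟨ cong (ℕ._+ shifted k) (left-commute (m C k) s (rising (suc s) k)) ⟩
    s ℕ.* 𝔻-coefficient (suc s) m k ℕ.+ shifted k ∎

𝔻-difference-in-r : ∀ s m x → 𝔻 (suc s) (suc m) x ≡ 𝔻 s (suc m) x + x * + suc m * 𝔻 (suc s) m x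
𝔻-difference-in-r s m x = begin
  𝔻 (suc s) (suc m) x
    ≡⟨ poly-suc (suc m) (𝔻-coefficient (suc s) (suc m)) x ⟩
  + 1 + x * poly (suc m) (λ k → (suc m C suc k) ℕ.* rising (suc s) (suc k)) x
    ≡⟨ cong (λ p → + 1 + x * p) (poly-cong (suc m) x absorb) ⟩
  + 1 + x * poly (suc m) (λ k → shifted k ℕ.+ suc m ℕ.* 𝔻-coefficient (suc s) m k) x
    ≡⟨ cong (λ p → + 1 + x * p) (poly-+ (suc m) shifted (λ k → suc m ℕ.* 𝔻-coefficient (suc s) m k) x) ⟩
  + 1 + x * (poly (suc m) shifted x + poly (suc m) (λ k → suc m ℕ.* 𝔻-coefficient (suc s) m k) x)
    ≡⟨ cong (λ q → + 1 + x * (poly (suc m) shifted x + q)) (poly-* (suc m) (suc m) (𝔻-coefficient (suc s) m) x) ⟩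
  + 1 + x * (poly (suc m) shifted x + + suc m * 𝔻 (suc s) m x)
    ≡⟨ rearrange x (poly (suc m) shifted x) (+ suc m) (𝔻 (suc s) m x) ⟩
  + 1 + x * poly (suc m) shifted x + x * + suc m * 𝔻 (suc s) m x
    ≡⟨ cong (_+ x * + suc m * 𝔻 (suc s) m x) (poly-suc (suc m) (𝔻-coefficient s (suc m)) x) ⟨
  𝔻 s (suc m) x + x * + suc m * 𝔻 (suc s) m x ∎
  where
  open ≡-Reasoning
  shifted : ℕ → ℕ
  shifted k = (suc m C suc k) ℕ.* rising s (suc k)
  rearrange : ∀ x p a d → + 1 + x * (p + a * d) ≡ + 1 + x * p + x * a * d
  rearrange = solve-∀
  absorb : ∀ k → (suc m C suc k) ℕ.* rising (suc s) (suc k) ≡ shifted k ℕ.+ suc m ℕ.* 𝔻-coefficient (suc s) m k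
  absorb k = begin
    (suc m C suc k) ℕ.* rising (suc s) (suc k)
      ≡⟨ cong ((suc m C suc k) ℕ.*_) (rising-suc-base s k) ⟩
    (suc m C suc k) ℕ.* (rising s (suc k) ℕ.+ suc k ℕ.* rising (suc s) k)
      ≡⟨ ℕₚ.*-distribˡ-+ (suc m C suc k) (rising s (suc k)) _ ⟩
    shifted k ℕ.+ (suc m C suc k) ℕ.* (suc k ℕ.* rising (suc s) k)
      ≡⟨ cong (shifted k ℕ.+_) (ℕₚ.*-assoc (suc m C suc k) (suc k) _) ⟨
    shifted k ℕ.+ (suc m C suc k) ℕ.* suc k ℕ.* rising (suc s) k
      ≡⟨ cong (λ c → shifted k ℕ.+ c ℕ.* rising (suc s) k)
              (trans (ℕₚ.*-comm (suc m C suc k) (suc k)) ([1+k]*[1+m]C[1+k]≡[1+m]*mCk m k)) ⟩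
    shifted k ℕ.+ suc m ℕ.* (m C k) ℕ.* rising (suc s) k
      ≡⟨ cong (shifted k ℕ.+_) (ℕₚ.*-assoc (suc m) (m C k) _) ⟩
    shifted k ℕ.+ suc m ℕ.* 𝔻-coefficient (suc s) m k ∎

-- The Hankel matrix after k rounds of column differencing; ⊓ and ∸ interpolate between
-- the finished columns j ≤ k and the pending columns j ≥ k.
partiallyReducedHankel : ℕ → ℤ → ℕ → ℕ → ℕ → ℤ
partiallyReducedHankel r z k i j = z ^ (j ⊓ k) * + rising r (j ⊓ k) * 𝔻 (r ℕ.+ j ⊓ k) (i ℕ.+ (j ∸ k)) z

reducedColumn : ∀ r z {k} i {j} → j ≤ k →
                partiallyReducedHankel r z k i j ≡ z ^ j * + rising r j * 𝔻 (r ℕ.+ j) i z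
reducedColumn r z i j≤k rewrite ℕₚ.m≤n⇒m⊓n≡m j≤k | ℕₚ.m≤n⇒m∸n≡0 j≤k | ℕₚ.+-identityʳ i = refl

pendingColumn : ∀ r z {k} i {j} → k ≤ j →
                partiallyReducedHankel r z k i j ≡ z ^ k * + rising r k * 𝔻 (r ℕ.+ k) (i ℕ.+ (j ∸ k)) z
pendingColumn r z i k≤j rewrite ℕₚ.m≥n⇒m⊓n≡n k≤j = refl

partiallyReducedHankel-zero : ∀ r z i j → partiallyReducedHankel r z 0 i j ≡ 𝔻 r (i ℕ.+ j) z
partiallyReducedHankel-zero r z i j = begin
  partiallyReducedHankel r z 0 i j ≡⟨ pendingColumn r z i z≤n ⟩
  + 1 * + 1 * 𝔻 (r ℕ.+ 0) (i ℕ.+ j) z ≡⟨ ℤₚ.*-identityˡ _ ⟩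
  𝔻 (r ℕ.+ 0) (i ℕ.+ j) z ≡⟨ cong (λ s → 𝔻 s (i ℕ.+ j) z) (ℕₚ.+-identityʳ r) ⟩
  𝔻 r (i ℕ.+ j) z ∎
  where open ≡-Reasoning

reduce-pendingColumn : ∀ r z k i j → k ≤ j →
  differenceColumnsAbove k (partiallyReducedHankel r z k) i (suc j) ≡ partiallyReducedHankel r z (suc k) i (suc j)
reduce-pendingColumn r z k i j k≤j = begin
  differenceColumnsAbove k P i (suc j)
    ≡⟨ differenceColumnsAbove-> k P i j k≤j ⟩
  P i (suc j) - P i j
    ≡⟨ cong₂ _-_ (pendingColumn r z i (ℕₚ.m≤n⇒m≤1+n k≤j)) (pendingColumn r z i k≤j) ⟩
  c * 𝔻 (r ℕ.+ k) (i ℕ.+ (suc j ∸ k)) z - c * 𝔻 (r ℕ.+ k) N z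
    ≡⟨ cong (λ n → c * 𝔻 (r ℕ.+ k) n z - c * 𝔻 (r ℕ.+ k) N z) index ⟩
  c * 𝔻 (r ℕ.+ k) (suc N) z - c * 𝔻 (r ℕ.+ k) N z
    ≡⟨ cong (λ d → c * d - c * 𝔻 (r ℕ.+ k) N z) (𝔻-difference-in-n (r ℕ.+ k) N z) ⟩
  c * (𝔻 (r ℕ.+ k) N z + + (r ℕ.+ k) * z * 𝔻 (suc (r ℕ.+ k)) N z) - c * 𝔻 (r ℕ.+ k) N z
    ≡⟨ cancel (z ^ k) (+ rising r k) (+ (r ℕ.+ k)) z (𝔻 (r ℕ.+ k) N z) (𝔻 (suc (r ℕ.+ k)) N z) ⟩
  z * z ^ k * (+ rising r k * + (r ℕ.+ k)) * 𝔻 (suc (r ℕ.+ k)) N z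
    ≡⟨ cong₂ (λ a s → z * z ^ k * a * 𝔻 s N z) (ℤₚ.pos-* (rising r k) (r ℕ.+ k)) (ℕₚ.+-suc r k) ⟨
  z ^ suc k * + rising r (suc k) * 𝔻 (r ℕ.+ suc k) N z
    ≡⟨ pendingColumn r z i (s≤s k≤j) ⟨
  partiallyReducedHankel r z (suc k) i (suc j) ∎
  where
  open ≡-Reasoning
  P : ℕ → ℕ → ℤ
  P = partiallyReducedHankel r z k
  c : ℤ
  c = z ^ k * + rising r k
  N : ℕ
  N = i ℕ.+ (j ∸ k)
  index : i ℕ.+ (suc j ∸ k) ≡ suc N
  index = trans (cong (i ℕ.+_) (ℕₚ.+-∸-assoc 1 k≤j)) (ℕₚ.+-suc i (j ∸ k))
  cancel : ∀ a b s z d e → a * b * (d + s * z * e) - a * b * d ≡ z * a * (b * s) * e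
  cancel = solve-∀

reduce-step : ∀ r z k i j →
  differenceColumnsAbove k (partiallyReducedHankel r z k) i j ≡ partiallyReducedHankel r z (suc k) i j
reduce-step r z k i j with j ℕₚ.≤? k
... | yes j≤k = begin
  differenceColumnsAbove k (partiallyReducedHankel r z k) i j ≡⟨ differenceColumnsAbove-≤ k _ i j j≤k ⟩
  partiallyReducedHankel r z k i j                            ≡⟨ reducedColumn r z i j≤k ⟩
  z ^ j * + rising r j * 𝔻 (r ℕ.+ j) i z                      ≡⟨ reducedColumn r z i (ℕₚ.m≤n⇒m≤1+n j≤k) ⟨
  partiallyReducedHankel r z (suc k) i j                      ∎
  where open ≡-Reasoning
reduce-step r z k i zero    | no 0≰k = ⊥-elim (0≰k z≤n)
reduce-step r z k i (suc j) | no j≰k = reduce-pendingColumn r z k i j (ℕ.s≤s⁻¹ (ℕₚ.≰⇒> j≰k))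

det-partiallyReducedHankel : ∀ r z m k → det m (matrix (partiallyReducedHankel r z 0) m)
                                       ≡ det m (matrix (partiallyReducedHankel r z k) m)
det-partiallyReducedHankel r z m zero    = refl
det-partiallyReducedHankel r z m (suc k) = begin
  det m (matrix (partiallyReducedHankel r z 0) m)
    ≡⟨ det-partiallyReducedHankel r z m k ⟩
  det m (matrix (partiallyReducedHankel r z k) m)
    ≡⟨ det-differenceColumnsAbove m (partiallyReducedHankel r z k) k ⟨
  det m (matrix (differenceColumnsAbove k (partiallyReducedHankel r z k)) m)
    ≡⟨ det-cong m (λ i j → reduce-step r z k (toℕ i) (toℕ j)) ⟩
  det m (matrix (partiallyReducedHankel r z (suc k)) m) ∎
  where open ≡-Reasoning

Π-z*[1+i]≡z^m*m! : ∀ z m → Π m (λ i → z * + suc (toℕ i)) ≡ z ^ m * + (m !)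
Π-z*[1+i]≡z^m*m! z zero    = refl
Π-z*[1+i]≡z^m*m! z (suc m) = begin
  Π (suc m) (λ i → z * + suc (toℕ i))           ≡⟨ Π-last m (λ i → z * + suc i) ⟩
  Π m (λ i → z * + suc (toℕ i)) * (z * + suc m) ≡⟨ cong (_* (z * + suc m)) (Π-z*[1+i]≡z^m*m! z m) ⟩
  z ^ m * + (m !) * (z * + suc m)               ≡⟨ rearrange (z ^ m) (+ (m !)) z (+ suc m) ⟩
  z * z ^ m * (+ suc m * + (m !))               ≡⟨ cong (z * z ^ m *_) (ℤₚ.pos-* (suc m) (m !)) ⟨
  z ^ suc m * + (suc m !)                       ∎
  where
  open ≡-Reasoning
  rearrange : ∀ p f z s → p * f * (z * s) ≡ z * p * (s * f)
  rearrange = solve-∀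

det-𝔻-shifted-exponents : ∀ m s z → det m (matrix (λ i j → 𝔻 (s ℕ.+ j) i z) m)
                                    ≡ Π m (λ k → z ^ toℕ k * + (toℕ k !))
det-𝔻-shifted-exponents zero    s z = refl
det-𝔻-shifted-exponents (suc m) s z = begin
  det (suc m) (matrix G (suc m))
    ≡⟨ det-differenceColumnsAbove (suc m) G 0 ⟨
  det (suc m) (matrix (differenceColumnsAbove 0 G) (suc m))
    ≡⟨ det-first-row-pivot m (matrix (differenceColumnsAbove 0 G) (suc m))
                              (λ k → differenceColumnsAbove-> 0 G 0 (toℕ k) z≤n) ⟩
  + 1 * det m (λ i k → differenceColumnsAbove 0 G (suc (toℕ i)) (suc (toℕ k)))
    ≡⟨ ℤₚ.*-identityˡ _ ⟩
  det m (λ i k → differenceColumnsAbove 0 G (suc (toℕ i)) (suc (toℕ k)))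
    ≡⟨ det-cong m (λ i k → lower-block (toℕ i) (toℕ k)) ⟩
  det m (λ i k → (z * + suc (toℕ i)) * 𝔻 (suc s ℕ.+ toℕ k) (toℕ i) z)
    ≡⟨ det-scale-rows m (λ i → z * + suc (toℕ i)) (matrix (λ i j → 𝔻 (suc s ℕ.+ j) i z) m) ⟩
  Π m (λ i → z * + suc (toℕ i)) * det m (matrix (λ i j → 𝔻 (suc s ℕ.+ j) i z) m)
    ≡⟨ cong₂ _*_ (Π-z*[1+i]≡z^m*m! z m) (det-𝔻-shifted-exponents m (suc s) z) ⟩
  z ^ m * + (m !) * Π m (λ k → z ^ toℕ k * + (toℕ k !))
    ≡⟨ ℤₚ.*-comm (z ^ m * + (m !)) _ ⟩
  Π m (λ k → z ^ toℕ k * + (toℕ k !)) * (z ^ m * + (m !))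
    ≡⟨ Π-last m (λ k → z ^ k * + (k !)) ⟨
  Π (suc m) (λ k → z ^ toℕ k * + (toℕ k !)) ∎
  where
  open ≡-Reasoning
  G : ℕ → ℕ → ℤ
  G i j = 𝔻 (s ℕ.+ j) i z
  cancel : ∀ a b → a + b - a ≡ b
  cancel = solve-∀
  lower-block : ∀ i k → differenceColumnsAbove 0 G (suc i) (suc k) ≡ z * + suc i * 𝔻 (suc s ℕ.+ k) i z
  lower-block i k = begin
    differenceColumnsAbove 0 G (suc i) (suc k)
      ≡⟨ differenceColumnsAbove-> 0 G (suc i) k z≤n ⟩
    𝔻 (s ℕ.+ suc k) (suc i) z - 𝔻 (s ℕ.+ k) (suc i) z
      ≡⟨ cong (λ t → 𝔻 t (suc i) z - 𝔻 (s ℕ.+ k) (suc i) z) (ℕₚ.+-suc s k) ⟩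
    𝔻 (suc (s ℕ.+ k)) (suc i) z - 𝔻 (s ℕ.+ k) (suc i) z
      ≡⟨ cong (_- 𝔻 (s ℕ.+ k) (suc i) z) (𝔻-difference-in-r (s ℕ.+ k) i z) ⟩
    𝔻 (s ℕ.+ k) (suc i) z + z * + suc i * 𝔻 (suc s ℕ.+ k) i z - 𝔻 (s ℕ.+ k) (suc i) z
      ≡⟨ cancel (𝔻 (s ℕ.+ k) (suc i) z) _ ⟩
    z * + suc i * 𝔻 (suc s ℕ.+ k) i z ∎

product-closed-form : ∀ r z n →
  Π (suc n) (λ j → z ^ toℕ j * + rising r (toℕ j)) * Π (suc n) (λ k → z ^ toℕ k * + (toℕ k !))
    ≡ z ^ (n ℕ.* suc n) * + rising r n * Π n (λ k → + (rising r (toℕ k) ℕ.* (suc (toℕ k)) !))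
product-closed-form r z zero    = refl
product-closed-form r z (suc n) = begin
  Π (suc (suc n)) (a ∘ toℕ) * Π (suc (suc n)) (v ∘ toℕ)
    ≡⟨ cong₂ _*_ (Π-last (suc n) a) (Π-last (suc n) v) ⟩
  Π (suc n) (a ∘ toℕ) * a (suc n) * (Π (suc n) (v ∘ toℕ) * v (suc n))
    ≡⟨ interchange′ (Π (suc n) (a ∘ toℕ)) (a (suc n)) (Π (suc n) (v ∘ toℕ)) (v (suc n)) ⟩
  Π (suc n) (a ∘ toℕ) * Π (suc n) (v ∘ toℕ) * (a (suc n) * v (suc n))
    ≡⟨ cong (_* (a (suc n) * v (suc n))) (product-closed-form r z n) ⟩
  z ^ (n ℕ.* suc n) * + rising r n * Π n (b ∘ toℕ) * (z ^ suc n * + rising r (suc n) * (z ^ suc n * + (suc n !)))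
    ≡⟨ rearrange (z ^ (n ℕ.* suc n)) (+ rising r n) (Π n (b ∘ toℕ))
                 (z ^ suc n) (+ rising r (suc n)) (+ (suc n !)) ⟩
  z ^ (n ℕ.* suc n) * z ^ suc n * z ^ suc n * + rising r (suc n) * (Π n (b ∘ toℕ) * (+ rising r n * + (suc n !)))
    ≡⟨ cong₂ (λ p q → p * + rising r (suc n) * (Π n (b ∘ toℕ) * q))
             exponent (ℤₚ.pos-* (rising r n) (suc n !)) ⟨
  z ^ (suc n ℕ.* suc (suc n)) * + rising r (suc n) * (Π n (b ∘ toℕ) * b n)
    ≡⟨ cong (z ^ (suc n ℕ.* suc (suc n)) * + rising r (suc n) *_) (Π-last n b) ⟨
  z ^ (suc n ℕ.* suc (suc n)) * + rising r (suc n) * Π (suc n) (b ∘ toℕ) ∎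
  where
  open ≡-Reasoning
  a v b : ℕ → ℤ
  a j = z ^ j * + rising r j
  v k = z ^ k * + (k !)
  b k = + (rising r k ℕ.* (suc k) !)
  interchange′ : ∀ p x q y → p * x * (q * y) ≡ p * q * (x * y)
  interchange′ = solve-∀
  rearrange : ∀ e ρ π w ρ′ f → e * ρ * π * (w * ρ′ * (w * f)) ≡ e * w * w * ρ′ * (π * (ρ * f))
  rearrange = solve-∀
  exponent : z ^ (suc n ℕ.* suc (suc n)) ≡ z ^ (n ℕ.* suc n) * z ^ suc n * z ^ suc n
  exponent = begin
    z ^ (suc n ℕ.* suc (suc n))                  ≡⟨ cong (z ^_) (split n) ⟩
    z ^ (n ℕ.* suc n ℕ.+ suc n ℕ.+ suc n)        ≡⟨ ℤₚ.^-distribˡ-+-* z (n ℕ.* suc n ℕ.+ suc n) (suc n) ⟩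
    z ^ (n ℕ.* suc n ℕ.+ suc n) * z ^ suc n      ≡⟨ cong (_* z ^ suc n) (ℤₚ.^-distribˡ-+-* z (n ℕ.* suc n) (suc n)) ⟩
    z ^ (n ℕ.* suc n) * z ^ suc n * z ^ suc n    ∎
    where
    split : ∀ n → suc n ℕ.* suc (suc n) ≡ n ℕ.* suc n ℕ.+ suc n ℕ.+ suc n
    split = ℕ-solve-∀

theorem15 : (r : ℕ) → 1 ≤ r → (n : ℕ) → (z : ℤ) →
    det (ℕ.suc n) (λ i j → 𝔻 r (toℕ i ℕ.+ toℕ j) z)
      ≡ (z ^ (n ℕ.* ℕ.suc n)) * + rising r n
        * Π n (λ k → + (rising r (toℕ k) ℕ.* (ℕ.suc (toℕ k)) !))
theorem15 r _ n z = begin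
  det (suc n) (matrix (λ i j → 𝔻 r (i ℕ.+ j) z) (suc n))
    ≡⟨ det-cong (suc n) (λ i j → partiallyReducedHankel-zero r z (toℕ i) (toℕ j)) ⟨
  det (suc n) (matrix (partiallyReducedHankel r z 0) (suc n))
    ≡⟨ det-partiallyReducedHankel r z (suc n) n ⟩
  det (suc n) (matrix (partiallyReducedHankel r z n) (suc n))
    ≡⟨ det-cong (suc n) (λ i j → reducedColumn r z (toℕ i) (ℕ.s≤s⁻¹ (Finₚ.toℕ<n j))) ⟩
  det (suc n) (λ i j → (z ^ toℕ j * + rising r (toℕ j)) * 𝔻 (r ℕ.+ toℕ j) (toℕ i) z)
    ≡⟨ det-scale-columns (suc n) (λ j → z ^ toℕ j * + rising r (toℕ j))
                                 (matrix (λ i j → 𝔻 (r ℕ.+ j) i z) (suc n)) ⟩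
  Π (suc n) (λ j → z ^ toℕ j * + rising r (toℕ j)) * det (suc n) (matrix (λ i j → 𝔻 (r ℕ.+ j) i z) (suc n))
    ≡⟨ cong (Π (suc n) (λ j → z ^ toℕ j * + rising r (toℕ j)) *_) (det-𝔻-shifted-exponents (suc n) r z) ⟩
  Π (suc n) (λ j → z ^ toℕ j * + rising r (toℕ j)) * Π (suc n) (λ k → z ^ toℕ k * + (toℕ k !))
    ≡⟨ product-closed-form r z n ⟩
  z ^ (n ℕ.* suc n) * + rising r n * Π n (λ k → + (rising r (toℕ k) ℕ.* (suc (toℕ k)) !)) ∎
  where open ≡-Reasoning
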